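{- Let $\mathbf M$ be an induced substructure of a structure $\mathbf N$, let $\mathcal P$ be a partition of $\mathbf N$, and let $\mathcal Q$ be a partition of $\mathbf M$ which is finer than the restriction of $\mathcal P$ to $\mathbf M$. Then for all $v\in\mathbf M$ and all $r\in\mathbb N$, $B^r_{\mathcal Q,\mathbf M}(v)\subseteq B^r_{\mathcal P,\mathbf N}(v)$.
   Context: Structures are over the signature of graphs (a symmetric binary edge relation $E$), possibly with additional constants and binary relations. For a partition $\mathcal P$ of a structure $\mathbf K$, a $\mathcal P$-flip of $\mathbf K$ is a structure with the same domain, constants and other relations as $\mathbf K$ such that for some symmetric relation $Z\subseteq\mathcal P\times\mathcal P$, for all $u,v$: $u,v$ are adjacent in the flip iff ($u,v$ are adjacent in $\mathbf K$) XOR $(\mathcal P(u),\mathcal P(v))\in Z$, where $\mathcal P(x)$ is the part of $\mathcal P$ containing $x$. For $r\in\mathbb N$ and $u,v\in\mathbf K$, $u$ and $v$ are $r$-independent over $\mathcal P$ in $\mathbf K$ if some $\mathcal P$-flip of $\mathbf K$ has no path of length at most $r$ from $u$ to $v$. Then $B^r_{\mathcal P,\mathbf K}(v)$ is the set of $u\in\mathbf K$ that are not $r$-independent from $v$ over $\mathcal P$ in $\mathbf K$. The restriction of $\mathcal P$ to $\mathbf M$ is $\{P\cap\mathbf M: P\in\mathcal P\}\setminus\{\emptyset\}$. -}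

module Defs where

open import Data.Nat using (ℕ; zero; suc)
open import Data.Product using (Σ; _×_; _,_; proj₁; ∃)
open import Data.Sum using (_⊎_)
open import Relation.Nullary using (¬_)
open import Relation.Binary.PropositionalEquality using (_≡_)

record Signature : Set₁ where
  field
    Const  : Set
    RelSym : Set

record Structure (σ : Signature) : Set₁ where
  open Signature σ
  field
    Carrier : Set
    E       : Carrier → Carrier → Set
    E-sym   : ∀ {u v} → E u v → E v u
    const   : Const → Carrier
    rel     : RelSym → Carrier → Carrier → Set

open Structure public

-- A partition of K, given by a labelling of the elements with part names:
-- the parts are the nonempty fibres of the labelling.
record Partition (A : Set) : Set₁ where
  field
    Part : Set
    part : A → Part

open Partition public

PartOf : ∀ {A} → Partition A → Set
PartOf = Part

_XOR_ : Set → Set → Set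
A XOR B = (A × ¬ B) ⊎ (¬ A × B)

SymRel : Set → Set₁
SymRel X = Σ (X → X → Set) λ Z → ∀ {a b} → Z a b → Z b a

flip : ∀ {σ} (K : Structure σ) (𝒫 : Partition (Carrier K)) → SymRel (PartOf 𝒫) → Structure σ
flip K 𝒫 (Z , Z-sym) = record
  { Carrier = Carrier K
  ; E       = λ u v → E K u v XOR Z (part 𝒫 u) (part 𝒫 v)
  ; E-sym   = λ { (Data.Sum.inj₁ (e , nz)) → Data.Sum.inj₁ (E-sym K e , λ z → nz (Z-sym z))
                ; (Data.Sum.inj₂ (ne , z)) → Data.Sum.inj₂ ((λ e → ne (E-sym K e)) , Z-sym z) }
  ; const   = const K
  ; rel     = rel K
  }

data PathLE {σ} (K : Structure σ) : ℕ → Carrier K → Carrier K → Set where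
  here : ∀ {r u} → PathLE K r u u
  step : ∀ {r u w v} → E K u w → PathLE K r w v → PathLE K (suc r) u v

Independent : ∀ {σ} (K : Structure σ) (𝒫 : Partition (Carrier K)) (r : ℕ) → Carrier K → Carrier K → Set₁
Independent K 𝒫 r u v = Σ (SymRel (PartOf 𝒫)) λ Z → ¬ PathLE (flip K 𝒫 Z) r u v

Ball : ∀ {σ} (K : Structure σ) (𝒫 : Partition (Carrier K)) (r : ℕ) → Carrier K → Carrier K → Set₁
Ball K 𝒫 r v u = ¬ Independent K 𝒫 r u v

Induced : ∀ {σ} (N : Structure σ) (S : Carrier N → Set) →
          (∀ c → S (const N c)) → Structure σ
Induced N S hS = record
  { Carrier = Σ (Carrier N) S
  ; E       = λ x y → E N (proj₁ x) (proj₁ y)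
  ; E-sym   = E-sym N
  ; const   = λ c → const N c , hS c
  ; rel     = λ R x y → rel N R (proj₁ x) (proj₁ y)
  }

FinerThanRestriction : ∀ {σ} (N : Structure σ) (S : Carrier N → Set) (hS : ∀ c → S (const N c)) →
                       Partition (Σ (Carrier N) S) → Partition (Carrier N) → Set
FinerThanRestriction N S hS 𝒬 𝒫 =
  ∀ (x y : Σ (Carrier N) S) → part 𝒬 x ≡ part 𝒬 y → part 𝒫 (proj₁ x) ≡ part 𝒫 (proj₁ y)

{-# OPTIONS --safe #-}
module Submission where

-- A 𝒫-flip of N witnessing independence induces a 𝒬-flip of M: flip a pair of
-- 𝒬-parts exactly when some of their elements lie in a flipped pair of 𝒫-parts.
-- Since 𝒬 refines the restriction of 𝒫, two elements of M are then adjacent in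
-- the new flip iff they are adjacent in the old one, so every short path in
-- the 𝒬-flip of M is a short path in the 𝒫-flip of N.

open import Defs
open import Data.Nat using (ℕ)
open import Data.Product using (Σ; proj₁; _,_; _×_)
open import Data.Sum using (inj₁; inj₂)
open import Function using (_∘_)
open import Function.Bundles using (_⇔_; mk⇔; Equivalence)
open import Relation.Binary.PropositionalEquality using (_≡_; refl; subst₂)

PathLE-map : ∀ {σ τ} {K : Structure σ} {L : Structure τ} (f : Carrier K → Carrier L) →
             (∀ {x y} → E K x y → E L (f x) (f y)) →
             ∀ {r u v} → PathLE K r u v → PathLE L r (f u) (f v)
PathLE-map f f-edge here       = here
PathLE-map f f-edge (step e p) = step (f-edge e) (PathLE-map f f-edge p)

XOR-congʳ : ∀ {A B C : Set} → B ⇔ C → A XOR B → A XOR C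
XOR-congʳ B⇔C (inj₁ (a , ¬b)) = inj₁ (a , ¬b ∘ Equivalence.from B⇔C)
XOR-congʳ B⇔C (inj₂ (¬a , b)) = inj₂ (¬a , Equivalence.to B⇔C b)

module _ {A B : Set} (𝒬 : Partition A) (𝒫 : Partition B) (f : A → B) where

  pullbackSymRel : SymRel (PartOf 𝒫) → SymRel (PartOf 𝒬)
  pullbackSymRel (Z , Z-sym) = Z′ , Z′-sym
    where
    Z′ : Part 𝒬 → Part 𝒬 → Set
    Z′ a b = Σ A λ x → Σ A λ y →
             part 𝒬 x ≡ a × part 𝒬 y ≡ b × Z (part 𝒫 (f x)) (part 𝒫 (f y))
    Z′-sym : ∀ {a b} → Z′ a b → Z′ b a
    Z′-sym (x , y , x∈a , y∈b , z) = y , x , y∈b , x∈a , Z-sym z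

  pullbackSymRel-⇔ : (∀ x y → part 𝒬 x ≡ part 𝒬 y → part 𝒫 (f x) ≡ part 𝒫 (f y)) →
                     ∀ Z x y → proj₁ (pullbackSymRel Z) (part 𝒬 x) (part 𝒬 y)
                             ⇔ proj₁ Z (part 𝒫 (f x)) (part 𝒫 (f y))
  pullbackSymRel-⇔ finer (Z , _) x y = mk⇔
    (λ { (x′ , y′ , x′~x , y′~y , z) → subst₂ Z (finer x′ x x′~x) (finer y′ y y′~y) z })
    (λ z → x , y , refl , refl , z)

module _ {σ} (N : Structure σ) (S : Carrier N → Set) (hS : ∀ c → S (const N c))
         (𝒫 : Partition (Carrier N)) (𝒬 : Partition (Σ (Carrier N) S))
         (finer : FinerThanRestriction N S hS 𝒬 𝒫) where

  flip-Induced-PathLE : ∀ Z {r u v} →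
    PathLE (flip (Induced N S hS) 𝒬 (pullbackSymRel 𝒬 𝒫 proj₁ Z)) r u v →
    PathLE (flip N 𝒫 Z) r (proj₁ u) (proj₁ v)
  flip-Induced-PathLE Z = PathLE-map proj₁ (XOR-congʳ (pullbackSymRel-⇔ 𝒬 𝒫 proj₁ finer Z _ _))

  Independent-Induced : ∀ r u v → Independent N 𝒫 r (proj₁ u) (proj₁ v) →
                        Independent (Induced N S hS) 𝒬 r u v
  Independent-Induced r u v (Z , no-path) =
    pullbackSymRel 𝒬 𝒫 proj₁ Z , no-path ∘ flip-Induced-PathLE Z

lemma31 : ∀ {σ : Signature} (N : Structure σ) (S : Carrier N → Set)
            (hS : ∀ c → S (const N c))
            (𝒫 : Partition (Carrier N)) (𝒬 : Partition (Σ (Carrier N) S)) →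
            FinerThanRestriction N S hS 𝒬 𝒫 →
            ∀ (v : Σ (Carrier N) S) (r : ℕ) (u : Σ (Carrier N) S) →
            Ball (Induced N S hS) 𝒬 r v u → Ball N 𝒫 r (proj₁ v) (proj₁ u)
lemma31 N S hS 𝒫 𝒬 finer v r u u∈ball = u∈ball ∘ Independent-Induced N S hS 𝒫 𝒬 finer r u v
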